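{- Let $G$ be a graph of order $n\geq 3$ with no isolated vertex, consisting of components $G_1,\dots,G_\omega$ with $\omega\geq 2$. Then $\tau(G_1)+\tau(G_2)+\cdots+\tau(G_\omega)\leq\gamma(C(G))\leq n-\omega$.
   Context: All graphs are finite, undirected and simple. The central graph $C(G)$ is obtained from $G$ by subdividing each edge of $G$ exactly once and joining every pair of vertices non-adjacent in $G$ by an edge. $\gamma$ is the domination number and $\tau$ the vertex cover number (minimum size of a vertex cover). -}

module Defs where

open import Data.Nat using (ℕ; _≤_)
open import Data.Fin using (Fin; _<_)
open import Data.Bool using (Bool; true; false)
open import Data.List using (List; length; tabulate)
open import Data.Nat.ListAction using (sum)
open import Data.List.Membership.Propositional using (_∈_)
open import Data.List.Relation.Unary.Unique.Propositional using (Unique)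
open import Data.Product using (Σ; _×_; _,_; proj₁; proj₂; ∃)
open import Data.Sum using (_⊎_; inj₁; inj₂)
open import Data.Empty using (⊥)
open import Relation.Binary.PropositionalEquality using (_≡_; _≢_)
open import Relation.Binary.Construct.Closure.ReflexiveTransitive using (Star)
open import Function.Bundles using (_⇔_)

record Graph (n : ℕ) : Set where
  field
    adj    : Fin n → Fin n → Bool
    sym    : ∀ u v → adj u v ≡ adj v u
    irrefl : ∀ u → adj u u ≡ false
open Graph public

Adj : ∀ {n} → Graph n → Fin n → Fin n → Set
Adj G u v = adj G u v ≡ true

-- Generic notions for a graph given by a vertex type V and adjacency relation A.
-- Vertex sets are duplicate-free lists; their size is the length.

Dominating : {V : Set} → (V → V → Set) → List V → Set
Dominating {V} A D = ∀ v → v ∈ D ⊎ Σ V (λ u → u ∈ D × A u v)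

IsDominationNumber : {V : Set} → (V → V → Set) → ℕ → Set
IsDominationNumber {V} A k =
  Σ (List V) (λ D → Unique D × Dominating A D × length D ≡ k)
  × (∀ (D : List V) → Unique D → Dominating A D → k ≤ length D)

VertexCover : {V : Set} → (V → V → Set) → List V → Set
VertexCover A S = ∀ u v → A u v → u ∈ S ⊎ v ∈ S

IsVertexCoverNumber : {V : Set} → (V → V → Set) → ℕ → Set
IsVertexCoverNumber {V} A k =
  Σ (List V) (λ S → Unique S × VertexCover A S × length S ≡ k)
  × (∀ (S : List V) → Unique S → VertexCover A S → k ≤ length S)

NoIsolated : ∀ {n} → Graph n → Set
NoIsolated {n} G = ∀ v → Σ (Fin n) (λ u → Adj G v u)

Connected : ∀ {n} → Graph n → Fin n → Fin n → Set
Connected G = Star (Adj G)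

-- c labels the connected components of G bijectively by Fin ω:
-- every label is used, and two vertices get the same label iff they are connected.
IsComponentLabelling : ∀ {n ω} → Graph n → (Fin n → Fin ω) → Set
IsComponentLabelling {n} {ω} G c =
  (∀ (i : Fin ω) → Σ (Fin n) (λ v → c v ≡ i))
  × (∀ u v → (c u ≡ c v) ⇔ Connected G u v)

CompV : ∀ {n ω} → (Fin n → Fin ω) → Fin ω → Set
CompV {n} c i = Σ (Fin n) (λ v → c v ≡ i)

CompAdj : ∀ {n ω} → Graph n → (c : Fin n → Fin ω) → (i : Fin ω) → CompV c i → CompV c i → Set
CompAdj G c i x y = Adj G (proj₁ x) (proj₁ y)

Edge : ∀ {n} → Graph n → Set
Edge {n} G = Σ (Fin n × Fin n) (λ p → proj₁ p < proj₂ p × Adj G (proj₁ p) (proj₂ p))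

-- The central graph C(G): vertices are the vertices of G together with one
-- subdivision vertex per edge; a vertex u is adjacent to the subdivision vertex
-- of e iff u is an endpoint of e; two distinct vertices of G are adjacent iff
-- they are non-adjacent in G; subdivision vertices are pairwise non-adjacent.
CV : ∀ {n} → Graph n → Set
CV {n} G = Fin n ⊎ Edge G

CAdj : ∀ {n} → (G : Graph n) → CV G → CV G → Set
CAdj G (inj₁ u) (inj₁ v) = u ≢ v × adj G u v ≡ false
CAdj G (inj₁ u) (inj₂ e) = u ≡ proj₁ (proj₁ e) ⊎ u ≡ proj₂ (proj₁ e)
CAdj G (inj₂ e) (inj₁ u) = u ≡ proj₁ (proj₁ e) ⊎ u ≡ proj₂ (proj₁ e)
CAdj G (inj₂ e) (inj₂ f) = ⊥

sumFin : ∀ {ω} → (Fin ω → ℕ) → ℕ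
sumFin t = sum (tabulate t)

-- Lower bound: the subdivision vertex of an edge uv of G is adjacent in C(G) only to
-- u and v, so projecting a dominating set of C(G) onto V(G) (a subdivision vertex to
-- an endpoint of its edge) gives a vertex cover of G of no larger size; its traces on
-- the components are vertex covers of the components.
-- Upper bound: fix a representative in each component and take all other vertices.
-- A subdivision vertex has an endpoint that is not a representative, and a
-- representative v is dominated, through a non-edge of G, by a neighbour of the
-- representative of any other component (here ω ≥ 2 and the absence of isolated
-- vertices are used).
module Submission where

open import Defs
open import Data.Nat using (ℕ; _≤_; _∸_)
open import Data.Fin using (Fin)
open import Data.Product using (_×_)

open import Data.Nat using (zero; suc; _+_; z≤n; s≤s)
open import Data.Nat.Properties using (≰⇒>; +-mono-≤; +-suc; ≤-trans; ≤-reflexive; m+n≤o⇒m≤o∸n)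
open import Data.Fin using (zero; suc; _≟_; punchIn)
open import Data.Fin.Properties using (pigeonhole; <⇒≢; <-cmp; suc-injective; punchInᵢ≢i)
open import Data.Bool using (true; false)
open import Data.List using (List; []; _∷_; length; map; filter; tabulate; allFin; lookup; _++_; deduplicate)
open import Data.Nat.ListAction using (sum)
open import Data.List.Properties using (tabulate-cong; length-tabulate; length-map; length-++; length-deduplicate)
open import Data.List.Membership.Propositional using (_∈_)
open import Data.List.Membership.Propositional.Properties
  using (∈-lookup; ∈-allFin; ∈-map⁺; ∈-map⁻; ∈-filter⁺; ∈-filter⁻; ∈-deduplicate⁺)
open import Data.List.Relation.Unary.Any using (here; there)
import Data.List.Relation.Unary.All as All
open import Data.List.Relation.Unary.AllPairs using ([]; _∷_)
open import Data.List.Relation.Unary.Unique.Propositional using (Unique)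
open import Data.List.Relation.Unary.Unique.Propositional.Properties
  using (Unique[x∷xs]⇒x∉xs; allFin⁺) renaming (map⁺ to Unique-map⁺; filter⁺ to Unique-filter⁺; ++⁺ to Unique-++⁺)
open import Data.List.Relation.Unary.Unique.DecPropositional.Properties using (deduplicate-!)
open import Data.Product using (Σ; _,_; proj₁; proj₂)
open import Data.Sum using (_⊎_; inj₁; inj₂; swap)
open import Data.Sum.Properties using (inj₁-injective)
open import Function using (_∘_)
open import Function.Bundles using (Equivalence)
open import Relation.Nullary using (¬_; Dec; yes; no; ¬?; contradiction)
open import Relation.Binary using (tri<; tri≈; tri>)
open import Relation.Binary.PropositionalEquality as ≡ using (_≡_; _≢_; refl; cong; cong₂)
open import Relation.Binary.Construct.Closure.ReflexiveTransitive using (ε; _◅_)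
open import Axiom.UniquenessOfIdentityProofs using (module Decidable⇒UIP)

lookup-injective : ∀ {A : Set} {xs : List A} → Unique xs → ∀ i j → lookup xs i ≡ lookup xs j → i ≡ j
lookup-injective (_ ∷ _) zero zero _ = refl
lookup-injective (x∉ ∷ _) zero (suc j) eq = contradiction eq (All.lookup x∉ (∈-lookup j))
lookup-injective (x∉ ∷ _) (suc i) zero eq = contradiction (≡.sym eq) (All.lookup x∉ (∈-lookup i))
lookup-injective (_ ∷ u) (suc i) (suc j) eq = cong suc (lookup-injective u i j eq)

Unique⇒length≤ : ∀ {n} {xs : List (Fin n)} → Unique xs → length xs ≤ n
Unique⇒length≤ {n} {xs} u with length xs Data.Nat.≤? n
... | yes ≤n = ≤n
... | no ≰n with pigeonhole (≰⇒> ≰n) (lookup xs)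
...   | i , j , i<j , eq = contradiction (lookup-injective u i j eq) (<⇒≢ i<j)

∃≢ : ∀ {ω} → 2 ≤ ω → (k : Fin ω) → Σ (Fin ω) (λ j → j ≢ k)
∃≢ (s≤s (s≤s _)) k = punchIn k zero , punchInᵢ≢i k zero

sum-tabulate-mono-≤ : ∀ {ω} (f g : Fin ω → ℕ) → (∀ i → f i ≤ g i) → sum (tabulate f) ≤ sum (tabulate g)
sum-tabulate-mono-≤ {zero} f g f≤g = z≤n
sum-tabulate-mono-≤ {suc ω} f g f≤g =
  +-mono-≤ (f≤g zero) (sum-tabulate-mono-≤ (f ∘ suc) (g ∘ suc) (f≤g ∘ suc))

sum-tabulate-0 : ∀ ω → sum (tabulate {n = ω} (λ _ → 0)) ≡ 0
sum-tabulate-0 zero = refl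
sum-tabulate-0 (suc ω) = sum-tabulate-0 ω

sum-tabulate-suc-at : ∀ {ω} (f g : Fin ω → ℕ) (k : Fin ω) → f k ≡ suc (g k) → (∀ i → i ≢ k → f i ≡ g i)
                    → sum (tabulate f) ≡ suc (sum (tabulate g))
sum-tabulate-suc-at f g zero fk≡ f≡g =
  cong₂ _+_ fk≡ (cong sum (tabulate-cong (λ i → f≡g (suc i) λ ())))
sum-tabulate-suc-at f g (suc k) fk≡ f≡g = begin
  f zero + sum (tabulate (f ∘ suc))        ≡⟨ cong₂ _+_ (f≡g zero λ ()) sum-tail ⟩
  g zero + suc (sum (tabulate (g ∘ suc)))  ≡⟨ +-suc (g zero) _ ⟩
  suc (sum (tabulate g))                   ∎
  where
  open ≡.≡-Reasoning
  sum-tail : sum (tabulate (f ∘ suc)) ≡ suc (sum (tabulate (g ∘ suc)))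
  sum-tail = sum-tabulate-suc-at (f ∘ suc) (g ∘ suc) k fk≡ (λ i i≢k → f≡g (suc i) (i≢k ∘ suc-injective))

vertexCover-mono : ∀ {V : Set} {A : V → V → Set} {S T : List V}
                 → (∀ {x} → x ∈ S → x ∈ T) → VertexCover A S → VertexCover A T
vertexCover-mono S⊆T cover u v uv with cover u v uv
... | inj₁ u∈S = inj₁ (S⊆T u∈S)
... | inj₂ v∈S = inj₂ (S⊆T v∈S)

module Fibres {n ω} (c : Fin n → Fin ω) where

  fibre : (i : Fin ω) → List (Fin n) → List (CompV c i)
  fibre i [] = []
  fibre i (x ∷ xs) with c x ≟ i
  ... | yes cx≡i = (x , cx≡i) ∷ fibre i xs
  ... | no _ = fibre i xs

  ∈-fibre⁺ : ∀ {i x xs} (cx≡i : c x ≡ i) → x ∈ xs → (x , cx≡i) ∈ fibre i xs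
  ∈-fibre⁺ {i} {x} {y ∷ xs} cx≡i (here refl) with c x ≟ i
  ... | yes cx≡i′ = here (cong (x ,_) (Decidable⇒UIP.≡-irrelevant _≟_ cx≡i cx≡i′))
  ... | no cx≢i = contradiction cx≡i cx≢i
  ∈-fibre⁺ {i} {x} {y ∷ xs} cx≡i (there x∈xs) with c y ≟ i
  ... | yes _ = there (∈-fibre⁺ cx≡i x∈xs)
  ... | no _ = ∈-fibre⁺ cx≡i x∈xs

  ∈-fibre⁻ : ∀ {i xs} {y : CompV c i} → y ∈ fibre i xs → proj₁ y ∈ xs
  ∈-fibre⁻ {i} {x ∷ xs} y∈ with c x ≟ i | y∈
  ... | yes _ | here refl = here refl
  ... | yes _ | there y∈′ = there (∈-fibre⁻ y∈′)
  ... | no _ | y∈′ = there (∈-fibre⁻ y∈′)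

  fibre-Unique : ∀ {i xs} → Unique xs → Unique (fibre i xs)
  fibre-Unique {i} {[]} [] = []
  fibre-Unique {i} {x ∷ xs} u@(_ ∷ uxs) with c x ≟ i
  ... | yes _ = All.tabulate (λ { y∈ refl → Unique[x∷xs]⇒x∉xs u (∈-fibre⁻ y∈) }) ∷ fibre-Unique uxs
  ... | no _ = fibre-Unique uxs

  length-fibre-∷-≡ : ∀ x xs → length (fibre (c x) (x ∷ xs)) ≡ suc (length (fibre (c x) xs))
  length-fibre-∷-≡ x xs with c x ≟ c x
  ... | yes _ = refl
  ... | no cx≢cx = contradiction refl cx≢cx

  length-fibre-∷-≢ : ∀ {i} x xs → i ≢ c x → length (fibre i (x ∷ xs)) ≡ length (fibre i xs)
  length-fibre-∷-≢ {i} x xs i≢cx with c x ≟ i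
  ... | yes cx≡i = contradiction (≡.sym cx≡i) i≢cx
  ... | no _ = refl

  sum-length-fibre : ∀ xs → sum (tabulate (λ i → length (fibre i xs))) ≡ length xs
  sum-length-fibre [] = sum-tabulate-0 ω
  sum-length-fibre (x ∷ xs) =
    ≡.trans (sum-tabulate-suc-at _ _ (c x) (length-fibre-∷-≡ x xs) (λ i → length-fibre-∷-≢ x xs))
            (cong suc (sum-length-fibre xs))

  vertexCover-fibre : ∀ {A : Fin n → Fin n → Set} {S} i
                    → VertexCover A S → VertexCover (λ x y → A (proj₁ x) (proj₁ y)) (fibre i S)
  vertexCover-fibre i cover (u , cu≡i) (v , cv≡i) uv with cover u v uv
  ... | inj₁ u∈S = inj₁ (∈-fibre⁺ cu≡i u∈S)
  ... | inj₂ v∈S = inj₂ (∈-fibre⁺ cv≡i v∈S)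

  sum-fibreCoverNumbers≤ : ∀ {A : Fin n → Fin n → Set} (τ : Fin ω → ℕ)
                         → (∀ i → IsVertexCoverNumber (λ x y → A (proj₁ x) (proj₁ y)) (τ i))
                         → ∀ {S} → Unique S → VertexCover A S → sumFin τ ≤ length S
  sum-fibreCoverNumbers≤ τ isτ {S} uS cover =
    ≤-trans (sum-tabulate-mono-≤ τ _ (λ i → proj₂ (isτ i) (fibre i S) (fibre-Unique uS) (vertexCover-fibre i cover)))
            (≤-reflexive (sum-length-fibre S))

open Fibres using (sum-fibreCoverNumbers≤)

module _ {n} (G : Graph n) where

  adj⇒≢ : ∀ {u v} → Adj G u v → u ≢ v
  adj⇒≢ {u} uv refl = contradiction (≡.trans (≡.sym uv) (irrefl G u)) λ ()

  toVertex : CV G → Fin n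
  toVertex (inj₁ u) = u
  toVertex (inj₂ ((a , _) , _)) = a

  module _ {D : List (CV G)} (dom : Dominating (CAdj G) D) where

    dominating-coversEdge : (e : Edge G) → let ((a , b) , _) = e in a ∈ map toVertex D ⊎ b ∈ map toVertex D
    dominating-coversEdge e with dom (inj₂ e)
    ... | inj₁ e∈D = inj₁ (∈-map⁺ toVertex e∈D)
    ... | inj₂ (inj₁ u , u∈D , inj₁ refl) = inj₁ (∈-map⁺ toVertex u∈D)
    ... | inj₂ (inj₁ u , u∈D , inj₂ refl) = inj₂ (∈-map⁺ toVertex u∈D)

    dominating⇒vertexCover : VertexCover (Adj G) (map toVertex D)
    dominating⇒vertexCover a b ab with <-cmp a b
    ... | tri< a<b _ _ = dominating-coversEdge ((a , b) , a<b , ab)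
    ... | tri≈ _ a≡b _ = contradiction a≡b (adj⇒≢ ab)
    ... | tri> _ _ b<a = swap (dominating-coversEdge ((b , a) , b<a , ≡.trans (Graph.sym G b a) ab))

  sumτ≤γ : ∀ {ω} (c : Fin n → Fin ω) (τ : Fin ω → ℕ) → (∀ i → IsVertexCoverNumber (CompAdj G c i) (τ i))
         → ∀ {γ} → IsDominationNumber (CAdj G) γ → sumFin τ ≤ γ
  sumτ≤γ c τ isτ ((D , _ , dom , |D|≡γ) , _) =
    ≤-trans (sum-fibreCoverNumbers≤ c τ isτ (deduplicate-! _≟_ S)
                                     (vertexCover-mono (∈-deduplicate⁺ _≟_) (dominating⇒vertexCover dom)))
            (≤-trans (length-deduplicate _≟_ S) (≤-reflexive (≡.trans (length-map toVertex D) |D|≡γ)))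
    where S = map toVertex D

module Representatives {n ω} (G : Graph n) (c : Fin n → Fin ω) (lab : IsComponentLabelling G c) where

  rep : Fin ω → Fin n
  rep i = proj₁ (proj₁ lab i)

  c-rep : ∀ i → c (rep i) ≡ i
  c-rep i = proj₂ (proj₁ lab i)

  IsRep : Fin n → Set
  IsRep v = rep (c v) ≡ v

  ¬IsRep? : ∀ v → Dec (¬ IsRep v)
  ¬IsRep? v = ¬? (rep (c v) ≟ v)

  nonReps : List (Fin n)
  nonReps = filter ¬IsRep? (allFin n)

  ∈-nonReps : ∀ {v} → ¬ IsRep v → v ∈ nonReps
  ∈-nonReps ¬rep = ∈-filter⁺ ¬IsRep? (∈-allFin _) ¬rep

  nonReps-Unique : Unique nonReps
  nonReps-Unique = Unique-filter⁺ ¬IsRep? (allFin⁺ n)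

  length-nonReps : length nonReps ≤ n ∸ ω
  length-nonReps = m+n≤o⇒m≤o∸n (length nonReps) (≤-trans (≤-reflexive |nonReps++reps|) (Unique⇒length≤ unique))
    where
    reps : List (Fin n)
    reps = map rep (allFin ω)
    disjoint : ∀ {v} → ¬ (v ∈ nonReps × v ∈ reps)
    disjoint (v∈nonReps , v∈reps) with ∈-filter⁻ ¬IsRep? {xs = allFin n} v∈nonReps | ∈-map⁻ rep v∈reps
    ... | _ , ¬rep | i , _ , refl = ¬rep (cong rep (c-rep i))
    rep-injective : ∀ {i j} → rep i ≡ rep j → i ≡ j
    rep-injective {i} {j} eq = ≡.trans (≡.sym (c-rep i)) (≡.trans (cong c eq) (c-rep j))
    unique : Unique (nonReps ++ reps)
    unique = Unique-++⁺ nonReps-Unique (Unique-map⁺ rep-injective (allFin⁺ ω)) disjoint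
    |nonReps++reps| : length nonReps + ω ≡ length (nonReps ++ reps)
    |nonReps++reps| = ≡.sym (≡.trans (length-++ nonReps)
                                      (cong (length nonReps +_) (≡.trans (length-map rep (allFin ω)) (length-tabulate _))))

  adj⇒c≡ : ∀ {u v} → Adj G u v → c u ≡ c v
  adj⇒c≡ {u} {v} uv = Equivalence.from (proj₂ lab u v) (uv ◅ ε)

  c≢⇒¬adj : ∀ {u v} → c u ≢ c v → adj G u v ≡ false
  c≢⇒¬adj {u} {v} cu≢cv with adj G u v in uv
  ... | true = contradiction (adj⇒c≡ uv) cu≢cv
  ... | false = refl

  adj-rep⇒¬rep : ∀ {u v} → Adj G u v → IsRep u → ¬ IsRep v
  adj-rep⇒¬rep {u} {v} uv rep-u rep-v =
    adj⇒≢ G uv (≡.trans (≡.sym rep-u) (≡.trans (cong rep (adj⇒c≡ uv)) rep-v))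

  nonReps-dominating : NoIsolated G → 2 ≤ ω → Dominating (CAdj G) (map inj₁ nonReps)
  nonReps-dominating noIso ω≥2 (inj₁ v) with rep (c v) ≟ v
  ... | no ¬rep = inj₁ (∈-map⁺ inj₁ (∈-nonReps ¬rep))
  ... | yes _ = inj₂ (inj₁ x , ∈-map⁺ inj₁ (∈-nonReps ¬rep-x) , (cx≢cv ∘ cong c) , c≢⇒¬adj cx≢cv)
    where
    j = proj₁ (∃≢ ω≥2 (c v))
    x = proj₁ (noIso (rep j))
    rep-j-x : Adj G (rep j) x
    rep-j-x = proj₂ (noIso (rep j))
    ¬rep-x : ¬ IsRep x
    ¬rep-x = adj-rep⇒¬rep rep-j-x (cong rep (c-rep j))
    cx≡j : c x ≡ j
    cx≡j = ≡.trans (≡.sym (adj⇒c≡ rep-j-x)) (c-rep j)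
    cx≢cv : c x ≢ c v
    cx≢cv cx≡cv = proj₂ (∃≢ ω≥2 (c v)) (≡.trans (≡.sym cx≡j) cx≡cv)
  nonReps-dominating noIso ω≥2 (inj₂ ((a , b) , a<b , ab)) with rep (c a) ≟ a
  ... | no ¬rep-a = inj₂ (inj₁ a , ∈-map⁺ inj₁ (∈-nonReps ¬rep-a) , inj₁ refl)
  ... | yes rep-a = inj₂ (inj₁ b , ∈-map⁺ inj₁ (∈-nonReps (adj-rep⇒¬rep ab rep-a)) , inj₂ refl)

  γ≤n∸ω : NoIsolated G → 2 ≤ ω → ∀ {γ} → IsDominationNumber (CAdj G) γ → γ ≤ n ∸ ω
  γ≤n∸ω noIso ω≥2 (_ , minimal) =
    ≤-trans (minimal (map inj₁ nonReps) unique (nonReps-dominating noIso ω≥2))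
            (≤-trans (≤-reflexive (length-map inj₁ nonReps)) length-nonReps)
    where unique = Unique-map⁺ inj₁-injective nonReps-Unique

corollary2p8 : ∀ {n} (G : Graph n) → 3 ≤ n → NoIsolated G
    → (ω : ℕ) → 2 ≤ ω → (c : Fin n → Fin ω) → IsComponentLabelling G c
    → (τ : Fin ω → ℕ) → (∀ i → IsVertexCoverNumber (CompAdj G c i) (τ i))
    → (γ : ℕ) → IsDominationNumber (CAdj G) γ
    → sumFin τ ≤ γ × γ ≤ n ∸ ω
corollary2p8 G _ noIso ω ω≥2 c lab τ isτ γ isγ =
  sumτ≤γ G c τ isτ isγ , Representatives.γ≤n∸ω G c lab noIso ω≥2 isγ
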